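{- Let $\lambda\vdash n$ and $\alpha\models n$. If $f_{\lambda\alpha}\ne0$, then $\alpha\ge\overline{\lambda}$ in dominance order.
   Context: A (strong) composition of $n$ is a finite sequence $\alpha=(\alpha_1,\dots,\alpha_l)$ of positive integers summing to $n$; write $\alpha\models n$. Dominance order: $\alpha\ge\beta$ iff $\alpha_1+\dots+\alpha_i\ge\beta_1+\dots+\beta_i$ for all $i$ (missing parts taken as $0$). For $\lambda\vdash n$ and $T\in\mathrm{SYT}(\lambda)$ (standard Young tableaux of shape $\lambda$), $\mathrm{Des}\,T=\{i\in\{1,\dots,n-1\}: i+1 \text{ lies in a row strictly below the row of } i\}$; if $\mathrm{Des}\,T=\{a_1<\dots<a_k\}$, $\mathrm{des}\,T=(a_1,a_2-a_1,\dots,a_k-a_{k-1},n-a_k)$; $f_{\lambda\alpha}=\#\{T\in\mathrm{SYT}(\lambda):\mathrm{des}\,T=\alpha\}$. The composition $\overline{\lambda}\models n$: if $\lambda=(n)$ is a single row, $\overline{\lambda}=(n)$; otherwise write the conjugate partition as $\lambda'=(\lambda'_1,\dots,\lambda'_l,1^L)$ with $l\ge1$, $\lambda'_l\ge2$, $L\ge0$, and let $\overline{\lambda}$ be the concatenation of $(1^{\lambda'_1-1})$, then the blocks $(2,1^{\lambda'_j-2})$ for $j=2,\dots,l$ in order, then $(L+1)$ (e.g. $\lambda=(3,3,1)$, $\lambda'=(3,2,2)$, gives $\overline{\lambda}=(1,1,2,2,1)$). -}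

module Defs where

open import Data.Bool using (Bool; true; false; if_then_else_)
open import Data.Nat using (ℕ; zero; suc; _+_; _∸_; _≤_; _<_; _≥_; _≤ᵇ_; _<ᵇ_; _≡ᵇ_)
open import Data.List using (List; []; _∷_; _++_; [_]; length; take; map; concat; concatMap;
  replicate; applyUpTo; filterᵇ; takeWhileᵇ)
open import Data.Nat.ListAction using (sum)
open import Data.Bool.ListAction using (any)
open import Data.List.Relation.Unary.All using (All)
open import Data.List.Relation.Unary.Linked using (Linked)
open import Data.List.Relation.Binary.Permutation.Propositional using (_↭_)
open import Data.Maybe using (Maybe; just; nothing)
open import Relation.Binary.PropositionalEquality using (_≡_)
open import Data.Product using (_×_)

IsPartition : ℕ → List ℕ → Set
IsPartition n λ' = All (0 <_) λ' × Linked _≥_ λ' × sum λ' ≡ n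

IsComposition : ℕ → List ℕ → Set
IsComposition n α = All (0 <_) α × sum α ≡ n

-- dominance: α ≥ β iff all partial sums of α dominate those of β
-- (take i pads missing parts by 0 automatically)
Dominates : List ℕ → List ℕ → Set
Dominates α β = ∀ i → sum (take i β) ≤ sum (take i α)

-- a tableau is a list of rows; entries are numbered from 1
nth : {A : Set} → List A → ℕ → Maybe A
nth []       _       = nothing
nth (x ∷ xs) zero    = just x
nth (x ∷ xs) (suc i) = nth xs i

entry : List (List ℕ) → ℕ → ℕ → Maybe ℕ
entry T i j with nth T i
... | nothing = nothing
... | just r  = nth r j

IsSYT : ℕ → List ℕ → List (List ℕ) → Set
IsSYT n λ' T =
  (map length T ≡ λ') ×
  (concat T ↭ applyUpTo suc n) ×
  All (Linked _<_) T ×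
  (∀ i j x y → entry T i j ≡ just x → entry T (suc i) j ≡ just y → x < y)

-- index (from 0, top row first) of the row containing k
rowOf : List (List ℕ) → ℕ → ℕ
rowOf []       k = 0
rowOf (r ∷ rs) k = if any (_≡ᵇ k) r then 0 else suc (rowOf rs k)

Des : ℕ → List (List ℕ) → List ℕ
Des n T = filterᵇ (λ i → rowOf T i <ᵇ rowOf T (suc i)) (applyUpTo suc (n ∸ 1))

diffs : ℕ → ℕ → List ℕ → List ℕ
diffs n prev []       = [ n ∸ prev ]
diffs n prev (a ∷ as) = (a ∸ prev) ∷ diffs n a as

des : ℕ → List (List ℕ) → List ℕ
des n T = diffs n 0 (Des n T)

headOr0 : List ℕ → ℕ
headOr0 []      = 0
headOr0 (x ∷ _) = x

conjugate : List ℕ → List ℕ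
conjugate λ' = applyUpTo (λ j → length (filterᵇ (λ p → suc j ≤ᵇ p) λ')) (headOr0 λ')

-- the composition λ̄
-- conjugate = (c₁,…,c_l,1^L) with c_l ≥ 2; bigCols = (c₁,…,c_l)
lambdaBar : List ℕ → List ℕ
lambdaBar λ' with takeWhileᵇ (2 ≤ᵇ_) (conjugate λ')
... | []       = λ'   -- single row (n) (or empty partition)
... | c₁ ∷ cs  =
  replicate (c₁ ∸ 1) 1
  ++ concatMap (λ c → 2 ∷ replicate (c ∸ 2) 1) cs
  ++ [ suc (length (conjugate λ') ∸ suc (length cs)) ]

-- Let t be the number of non-descents among 1, …, m and d = m − t the number of descents.
-- Between two entries of one row there is a non-descent, so each row holds at most t + 1 of
-- the entries 1, …, m + 1, whence m + 1 ≤ Σᵢ min(λᵢ, t + 1) = λ'₁ + ⋯ + λ'_{t+1}.  In λ̄ the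
-- parts exceeding 1 (before the last) are the 2's opening the column blocks, and the (t+1)-st
-- of them comes after λ'₁ + ⋯ + λ'_{t+1} − t parts; hence λ̄₁ + ⋯ + λ̄_d ≤ d + t = m.  Taking
-- m to be the d-th descent bounds the d-th partial sum of λ̄ by that of des T.
module Submission where

open import Defs
open import Data.Nat
open import Data.Nat.Properties
open import Data.Bool as Bool using (Bool; true; false; T; T?; not; _∧_; _∨_)
open import Data.Bool.Properties using (∧-zeroʳ)
open import Data.Bool.ListAction using (any)
open import Data.Nat.ListAction using (sum)
open import Data.Nat.ListAction.Properties using (sum-++)
open import Data.List using (List; []; _∷_; _++_; [_]; length; take; map; concat; concatMap;
  replicate; applyUpTo; filterᵇ; takeWhileᵇ; dropWhileᵇ)
open import Data.Unit using (⊤; tt)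
open import Data.Product using (_×_; _,_)
open import Function using (_∘_; id; flip)
open import Relation.Nullary using (contradiction)
open import Data.List.Properties
  using (map-∘; map-cong-local; map-id; ++-assoc; length-++; applyUpTo-∷ʳ; filter-++;
         takeWhile++dropWhile)
open import Data.List.Relation.Unary.All as All using (All; []; _∷_)
import Data.List.Relation.Unary.All.Properties as All
open import Data.List.Relation.Unary.Linked as Linked using (Linked)
import Data.List.Relation.Unary.Linked.Properties as Linkedₚ
open import Data.Sum using (inj₁; inj₂)
open import Data.List.Relation.Binary.Permutation.Propositional using (_↭_; ↭-sym)
open import Data.List.Relation.Binary.Permutation.Propositional.Properties using (∈-resp-↭)
open import Data.List.Membership.Propositional using (_∈_)
open import Data.List.Membership.Propositional.Properties using (∈-applyUpTo⁺; ∈-++⁻)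
import Data.List.Relation.Unary.Any as Any
open import Data.List.Relation.Unary.Any.Properties using (any⁺)
open import Relation.Binary.PropositionalEquality hiding ([_])
open import Algebra.Properties.CommutativeSemigroup +-commutativeSemigroup using (interchange)

indicator : Bool → ℕ
indicator true  = 1
indicator false = 0

count : (ℕ → Bool) → ℕ → ℕ
count p zero    = 0
count p (suc k) = count p k + indicator (p (suc k))

module _ {p q : ℕ → Bool} where

  count-cong : (∀ y → p y ≡ q y) → ∀ k → count p k ≡ count q k
  count-cong p≗q zero    = refl
  count-cong p≗q (suc k) = cong₂ _+_ (count-cong p≗q k) (cong indicator (p≗q (suc k)))

  count-mono : (∀ y → indicator (p y) ≤ indicator (q y)) → ∀ k → count p k ≤ count q k
  count-mono p≤q zero    = z≤n
  count-mono p≤q (suc k) = +-mono-≤ (count-mono p≤q k) (p≤q (suc k))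

module _ {p p₁ p₂ : ℕ → Bool} where

  count-split : (∀ y → indicator (p y) ≡ indicator (p₁ y) + indicator (p₂ y)) →
                ∀ k → count p k ≡ count p₁ k + count p₂ k
  count-split split zero    = refl
  count-split split (suc k) = begin
    count p k + indicator (p (suc k))
      ≡⟨ cong₂ _+_ (count-split split k) (split (suc k)) ⟩
    count p₁ k + count p₂ k + (indicator (p₁ (suc k)) + indicator (p₂ (suc k)))
      ≡⟨ interchange (count p₁ k) _ _ _ ⟩
    count p₁ (suc k) + count p₂ (suc k) ∎
    where open ≡-Reasoning

  count-subadditive : (∀ y → indicator (p y) ≤ indicator (p₁ y) + indicator (p₂ y)) →
                      ∀ k → count p k ≤ count p₁ k + count p₂ k
  count-subadditive split zero    = z≤n
  count-subadditive split (suc k) = begin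
    count p k + indicator (p (suc k))
      ≤⟨ +-mono-≤ (count-subadditive split k) (split (suc k)) ⟩
    count p₁ k + count p₂ k + (indicator (p₁ (suc k)) + indicator (p₂ (suc k)))
      ≡⟨ interchange (count p₁ k) _ _ _ ⟩
    count p₁ (suc k) + count p₂ (suc k) ∎
    where open ≤-Reasoning

count-false : ∀ {p} k → (∀ y → 1 ≤ y → y ≤ k → p y ≡ false) → count p k ≡ 0
count-false zero    p-false = refl
count-false (suc k) p-false
  rewrite count-false k (λ y 1≤y y≤k → p-false y 1≤y (m≤n⇒m≤1+n y≤k))
        | p-false (suc k) (s≤s z≤n) ≤-refl = refl

count-true : ∀ {p} k → (∀ y → 1 ≤ y → y ≤ k → T (p y)) → count p k ≡ k
count-true zero    p-true = refl
count-true {p} (suc k) p-true with p (suc k) | p-true (suc k) (s≤s z≤n) ≤-refl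
... | true | _ = trans (cong (_+ 1) (count-true k (λ y 1≤y y≤k → p-true y 1≤y (m≤n⇒m≤1+n y≤k))))
                      (+-comm k 1)

count-not : ∀ p k → count p k + count (not ∘ p) k ≡ k
count-not p k = begin
  count p k + count (not ∘ p) k ≡⟨ count-split (λ y → indicator-not (p y)) k ⟨
  count (λ _ → true) k          ≡⟨ count-true k (λ _ _ _ → tt) ⟩
  k                             ∎
  where
  open ≡-Reasoning
  indicator-not : ∀ b → 1 ≡ indicator b + indicator (not b)
  indicator-not true  = refl
  indicator-not false = refl

m<n⇒n≡ᵇm≡false : ∀ {m n} → m < n → (n ≡ᵇ m) ≡ false
m<n⇒n≡ᵇm≡false {zero}  (s≤s _)   = refl
m<n⇒n≡ᵇm≡false {suc m} (s≤s m<n) = m<n⇒n≡ᵇm≡false m<n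

count-≡ᵇ : ∀ a k → count (a ≡ᵇ_) k ≤ 1
count-≡ᵇ a zero    = z≤n
count-≡ᵇ a (suc k) with a ≡ᵇ suc k in a≡ᵇ1+k
... | false rewrite +-identityʳ (count (a ≡ᵇ_) k) = count-≡ᵇ a k
... | true with refl ← ≡ᵇ⇒≡ a (suc k) (subst T (sym a≡ᵇ1+k) tt)
  rewrite count-false k (λ y _ y≤k → m<n⇒n≡ᵇm≡false (s≤s y≤k)) = ≤-refl

_∈ᵇ_ : ℕ → List ℕ → Bool
y ∈ᵇ row = any (_≡ᵇ y) row

count-∈ᵇ : ∀ row k → count (_∈ᵇ row) k ≤ length row
count-∈ᵇ []        k = ≤-reflexive (count-false k (λ _ _ _ → refl))
count-∈ᵇ (a ∷ row) k = begin
  count (_∈ᵇ (a ∷ row)) k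
    ≤⟨ count-subadditive (λ y → indicator-∨ (a ≡ᵇ y) (y ∈ᵇ row)) k ⟩
  count (a ≡ᵇ_) k + count (_∈ᵇ row) k
    ≤⟨ +-mono-≤ (count-≡ᵇ a k) (count-∈ᵇ row k) ⟩
  suc (length row)                    ∎
  where
  open ≤-Reasoning
  indicator-∨ : ∀ b c → indicator (b ∨ c) ≤ indicator b + indicator c
  indicator-∨ true  c = s≤s z≤n
  indicator-∨ false c = ≤-refl

nonAscents : (ℕ → ℕ) → ℕ → ℕ
nonAscents ρ = count (λ j → not (ρ j <ᵇ ρ (suc j)))

≡ᵇ+<ᵇ≤1 : ∀ v r → indicator (v ≡ᵇ r) + indicator (v <ᵇ r) ≤ 1
≡ᵇ+<ᵇ≤1 zero    zero    = ≤-refl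
≡ᵇ+<ᵇ≤1 zero    (suc r) = ≤-refl
≡ᵇ+<ᵇ≤1 (suc v) zero    = z≤n
≡ᵇ+<ᵇ≤1 (suc v) (suc r) = ≡ᵇ+<ᵇ≤1 v r

-- If v ≤ r then either u < r or v ≤ u.
occurrence-step : ∀ u v r →
  indicator (v ≡ᵇ r) + indicator (v <ᵇ r) ≤ indicator (u <ᵇ r) + indicator (not (u <ᵇ v))
occurrence-step zero    zero    zero    = ≤-refl
occurrence-step (suc u) zero    zero    = ≤-refl
occurrence-step zero    zero    (suc r) = m≤m+n 1 1
occurrence-step (suc u) zero    (suc r) = m≤n+m 1 _
occurrence-step u       (suc v) zero    = z≤n
occurrence-step zero    (suc v) (suc r) = ≡ᵇ+<ᵇ≤1 v r
occurrence-step (suc u) (suc v) (suc r) = occurrence-step u v r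

-- The term [ρ (k+1) < r] records that the next occurrence of r needs a new non-ascent.
occurrences-invariant : ∀ ρ r k →
  count (λ y → ρ y ≡ᵇ r) (suc k) + indicator (ρ (suc k) <ᵇ r) ≤ suc (nonAscents ρ k)
occurrences-invariant ρ r zero    = ≡ᵇ+<ᵇ≤1 (ρ 1) r
occurrences-invariant ρ r (suc k) = begin
  C + indicator (v ≡ᵇ r) + indicator (v <ᵇ r)         ≡⟨ +-assoc C _ _ ⟩
  C + (indicator (v ≡ᵇ r) + indicator (v <ᵇ r))       ≤⟨ +-monoʳ-≤ C (occurrence-step u v r) ⟩
  C + (indicator (u <ᵇ r) + indicator (not (u <ᵇ v))) ≡⟨ +-assoc C _ _ ⟨
  C + indicator (u <ᵇ r) + indicator (not (u <ᵇ v))   ≤⟨ +-monoˡ-≤ _ (occurrences-invariant ρ r k) ⟩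
  suc (nonAscents ρ (suc k))                          ∎
  where
  open ≤-Reasoning
  C u v : ℕ
  C = count (λ y → ρ y ≡ᵇ r) (suc k)
  u = ρ (suc k)
  v = ρ (suc (suc k))

occurrences≤1+nonAscents : ∀ ρ r k → count (λ y → ρ y ≡ᵇ r) (suc k) ≤ suc (nonAscents ρ k)
occurrences≤1+nonAscents ρ r k = m+n≤o⇒m≤o _ (occurrences-invariant ρ r k)

module _ (row : List ℕ) (rs : List (List ℕ)) (y : ℕ) where

  rowOf-∷-<ᵇ : ∀ q → indicator (q ∧ (rowOf (row ∷ rs) y <ᵇ suc (length rs))) ≡
    indicator (q ∧ (y ∈ᵇ row)) + indicator ((q ∧ not (y ∈ᵇ row)) ∧ (rowOf rs y <ᵇ length rs))
  rowOf-∷-<ᵇ false = refl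
  rowOf-∷-<ᵇ true with y ∈ᵇ row
  ... | true  = refl
  ... | false = refl

  rowOf-∷-≡ᵇ-zero : ∀ q → (q ∧ (rowOf (row ∷ rs) y ≡ᵇ 0)) ≡ q ∧ (y ∈ᵇ row)
  rowOf-∷-≡ᵇ-zero false = refl
  rowOf-∷-≡ᵇ-zero true with y ∈ᵇ row
  ... | true  = refl
  ... | false = refl

  rowOf-∷-≡ᵇ-suc : ∀ q r →
    (q ∧ (rowOf (row ∷ rs) y ≡ᵇ suc r)) ≡ (q ∧ not (y ∈ᵇ row)) ∧ (rowOf rs y ≡ᵇ r)
  rowOf-∷-≡ᵇ-suc false r = refl
  rowOf-∷-≡ᵇ-suc true  r with y ∈ᵇ row
  ... | true  = refl
  ... | false = refl

count-in-rows : ∀ (T : List (List ℕ)) (q : ℕ → Bool) k s →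
  (∀ r → count (λ y → q y ∧ (rowOf T y ≡ᵇ r)) k ≤ s) →
  count (λ y → q y ∧ (rowOf T y <ᵇ length T)) k ≤ sum (map (λ row → length row ⊓ s) T)
count-in-rows []         q k s _        = ≤-reflexive (count-false k (λ y _ _ → ∧-zeroʳ (q y)))
count-in-rows (row ∷ rs) q k s rows≤s = begin
  count (λ y → q y ∧ (rowOf (row ∷ rs) y <ᵇ suc (length rs))) k
    ≡⟨ count-split (λ y → rowOf-∷-<ᵇ row rs y (q y)) k ⟩
  count inFirst k + count (λ y → q′ y ∧ (rowOf rs y <ᵇ length rs)) k
    ≤⟨ +-mono-≤ (⊓-glb inFirst≤length inFirst≤s)
                (count-in-rows rs q′ k s (λ r → ≤-trans (≤-reflexive (count-cong (λ y →
                  sym (rowOf-∷-≡ᵇ-suc row rs y (q y) r)) k)) (rows≤s (suc r)))) ⟩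
  length row ⊓ s + sum (map (λ row → length row ⊓ s) rs) ∎
  where
  open ≤-Reasoning
  inFirst q′ : ℕ → Bool
  inFirst y = q y ∧ (y ∈ᵇ row)
  q′ y = q y ∧ not (y ∈ᵇ row)
  inFirst≤length : count inFirst k ≤ length row
  inFirst≤length = ≤-trans (count-mono (λ y → indicator-∧ (q y) (y ∈ᵇ row)) k) (count-∈ᵇ row k)
    where
    indicator-∧ : ∀ b c → indicator (b ∧ c) ≤ indicator c
    indicator-∧ true  c = ≤-refl
    indicator-∧ false c = z≤n
  inFirst≤s : count inFirst k ≤ s
  inFirst≤s = ≤-trans (≤-reflexive (count-cong (λ y → sym (rowOf-∷-≡ᵇ-zero row rs y (q y))) k))
                      (rows≤s 0)

∈⇒∈ᵇ : ∀ {y row} → y ∈ row → T (y ∈ᵇ row)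
∈⇒∈ᵇ {y} = any⁺ (_≡ᵇ y) ∘ Any.map (λ { refl → ≡⇒≡ᵇ y y refl })

rowOf<length : ∀ rows {y} → y ∈ concat rows → rowOf rows y < length rows
rowOf<length (row ∷ rs) {y} y∈T with y ∈ᵇ row in y∈ᵇrow
... | true  = s≤s z≤n
... | false with ∈-++⁻ row y∈T
...   | inj₁ y∈row with () ← subst T y∈ᵇrow (∈⇒∈ᵇ y∈row)
...   | inj₂ y∈rs  = s≤s (rowOf<length rs y∈rs)

prefix≤rowCapacity : ∀ n T → concat T ↭ applyUpTo suc n → ∀ m → suc m ≤ n →
  suc m ≤ sum (map (_⊓ suc (nonAscents (rowOf T) m)) (map length T))
prefix≤rowCapacity n T entries m 1+m≤n = begin
  suc m                                       ≡⟨ count-true (suc m) inTableau ⟨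
  count (λ y → rowOf T y <ᵇ length T) (suc m) ≤⟨ count-in-rows T (λ _ → true) (suc m) _
                                                   (λ r → occurrences≤1+nonAscents (rowOf T) r m) ⟩
  sum (map (λ row → length row ⊓ s) T)        ≡⟨ cong sum (map-∘ T) ⟩
  sum (map (_⊓ s) (map length T))             ∎
  where
  open ≤-Reasoning
  s : ℕ
  s = suc (nonAscents (rowOf T) m)
  inTableau : ∀ y → 1 ≤ y → y ≤ suc m → Bool.T (rowOf T y <ᵇ length T)
  inTableau (suc y) _ y<1+m = <⇒<ᵇ (rowOf<length T
    (∈-resp-↭ (↭-sym entries) (∈-applyUpTo⁺ suc (≤-trans y<1+m 1+m≤n))))

columnLength : List ℕ → ℕ → ℕ
columnLength λ' j = length (filterᵇ (λ p → suc j ≤ᵇ p) λ')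

length-filterᵇ-∷ : ∀ (p : ℕ → Bool) a xs →
  length (filterᵇ p (a ∷ xs)) ≡ indicator (p a) + length (filterᵇ p xs)
length-filterᵇ-∷ p a xs with p a
... | true  = refl
... | false = refl

take-applyUpTo : ∀ (f : ℕ → ℕ) s N → take s (applyUpTo f N) ≡ applyUpTo f (s ⊓ N)
take-applyUpTo f zero    N       = refl
take-applyUpTo f (suc s) zero    = refl
take-applyUpTo f (suc s) (suc N) = cong (f 0 ∷_) (take-applyUpTo (f ∘ suc) s N)

sum-applyUpTo-+ : ∀ (f g : ℕ → ℕ) M →
  sum (applyUpTo (λ j → f j + g j) M) ≡ sum (applyUpTo f M) + sum (applyUpTo g M)
sum-applyUpTo-+ f g zero    = refl
sum-applyUpTo-+ f g (suc M) = trans (cong (f 0 + g 0 +_) (sum-applyUpTo-+ (f ∘ suc) (g ∘ suc) M))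
                                    (interchange (f 0) (g 0) _ _)

sum-applyUpTo-≤ᵇ : ∀ a M → sum (applyUpTo (λ j → indicator (suc j ≤ᵇ a)) M) ≡ a ⊓ M
sum-applyUpTo-≤ᵇ zero    zero    = refl
sum-applyUpTo-≤ᵇ (suc a) zero    = refl
sum-applyUpTo-≤ᵇ zero    (suc M) = sum-applyUpTo-≤ᵇ zero M
sum-applyUpTo-≤ᵇ (suc a) (suc M) = cong suc (sum-applyUpTo-≤ᵇ a M)

-- Both sides count the cells of λ lying in its first M columns.
sum-columnLength : ∀ λ' M → sum (applyUpTo (columnLength λ') M) ≡ sum (map (_⊓ M) λ')
sum-columnLength []        M = sum-zeros M
  where
  sum-zeros : ∀ M → sum (applyUpTo (λ _ → 0) M) ≡ 0
  sum-zeros zero    = refl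
  sum-zeros (suc M) = sum-zeros M
sum-columnLength (a ∷ λ') M = begin
  sum (applyUpTo (columnLength (a ∷ λ')) M)
    ≡⟨ cong sum (applyUpTo-cong (λ j → length-filterᵇ-∷ (λ p → suc j ≤ᵇ p) a λ') M) ⟩
  sum (applyUpTo (λ j → indicator (suc j ≤ᵇ a) + columnLength λ' j) M)
    ≡⟨ sum-applyUpTo-+ (λ j → indicator (suc j ≤ᵇ a)) (columnLength λ') M ⟩
  sum (applyUpTo (λ j → indicator (suc j ≤ᵇ a)) M) + sum (applyUpTo (columnLength λ') M)
    ≡⟨ cong₂ _+_ (sum-applyUpTo-≤ᵇ a M) (sum-columnLength λ' M) ⟩
  a ⊓ M + sum (map (_⊓ M) λ') ∎
  where
  open ≡-Reasoning
  applyUpTo-cong : ∀ {f g : ℕ → ℕ} → (∀ j → f j ≡ g j) → ∀ N → applyUpTo f N ≡ applyUpTo g N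
  applyUpTo-cong f≗g zero    = refl
  applyUpTo-cong f≗g (suc N) = cong₂ _∷_ (f≗g 0) (applyUpTo-cong (f≗g ∘ suc) N)

module _ (λ' : List ℕ) (≤head : All (_≤ headOr0 λ') λ') where

  sum-take-conjugate : ∀ s → sum (take s (conjugate λ')) ≡ sum (map (_⊓ s) λ')
  sum-take-conjugate s = begin
    sum (take s (conjugate λ'))               ≡⟨ cong sum (take-applyUpTo (columnLength λ') s h) ⟩
    sum (applyUpTo (columnLength λ') (s ⊓ h)) ≡⟨ sum-columnLength λ' (s ⊓ h) ⟩
    sum (map (_⊓ (s ⊓ h)) λ')                 ≡⟨ cong sum (map-cong-local (All.map ⊓-below ≤head)) ⟩
    sum (map (_⊓ s) λ')                       ∎
    where
    open ≡-Reasoning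
    h : ℕ
    h = headOr0 λ'
    ⊓-below : ∀ {x} → x ≤ h → x ⊓ (s ⊓ h) ≡ x ⊓ s
    ⊓-below {x} x≤h = begin
      x ⊓ (s ⊓ h) ≡⟨ cong (x ⊓_) (⊓-comm s h) ⟩
      x ⊓ (h ⊓ s) ≡⟨ ⊓-assoc x h s ⟨
      x ⊓ h ⊓ s   ≡⟨ cong (_⊓ s) (m≤n⇒m⊓n≡m x≤h) ⟩
      x ⊓ s       ∎

  sum-conjugate : sum (conjugate λ') ≡ sum λ'
  sum-conjugate = begin
    sum (conjugate λ')         ≡⟨ sum-columnLength λ' (headOr0 λ') ⟩
    sum (map (_⊓ headOr0 λ') λ') ≡⟨ cong sum (map-cong-local (All.map m≤n⇒m⊓n≡m ≤head)) ⟩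
    sum (map id λ')            ≡⟨ cong sum (map-id λ') ⟩
    sum λ'                     ∎
    where open ≡-Reasoning

columnLength-suc : ∀ λ' j → columnLength λ' (suc j) ≤ columnLength λ' j
columnLength-suc []        j = z≤n
columnLength-suc (a ∷ λ') j
  rewrite length-filterᵇ-∷ (λ p → suc (suc j) ≤ᵇ p) a λ'
        | length-filterᵇ-∷ (λ p → suc j ≤ᵇ p) a λ' =
  +-mono-≤ (indicator-<ᵇ j a) (columnLength-suc λ' j)
  where
  indicator-<ᵇ : ∀ j a → indicator (suc j <ᵇ a) ≤ indicator (j <ᵇ a)
  indicator-<ᵇ j       zero          = z≤n
  indicator-<ᵇ zero    (suc zero)    = z≤n
  indicator-<ᵇ zero    (suc (suc a)) = ≤-refl
  indicator-<ᵇ (suc j) (suc a)       = indicator-<ᵇ j a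

conjugate-linked : ∀ λ' → Linked _≥_ (conjugate λ')
conjugate-linked λ' = Linkedₚ.applyUpTo⁺₂ (columnLength λ') (headOr0 λ') (columnLength-suc λ')

conjugate-positive : ∀ λ' → All (1 ≤_) (conjugate λ')
conjugate-positive []        = []
conjugate-positive (a ∷ λ') = All.applyUpTo⁺₁ (columnLength (a ∷ λ')) a column≥1
  where
  column≥1 : ∀ {j} → j < a → 1 ≤ columnLength (a ∷ λ') j
  column≥1 {j} j<a rewrite length-filterᵇ-∷ (λ p → suc j ≤ᵇ p) a λ'
    with suc j ≤ᵇ a | ≤⇒≤ᵇ j<a
  ... | true | _ = s≤s z≤n

-- With Z = λ' and Y = λ̄ (s = 0): the first i parts of λ̄ contain at most t parts 2 as long
-- as i + t + 1 ≤ λ'₁ + ⋯ + λ'_{t+1}.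
ExcessBound : ℕ → List ℕ → List ℕ → Set
ExcessBound s Z Y = ∀ i t → i + suc t ≤ sum (take (suc t) Z) → sum (take i Y) ≤ i + t + s

sum-take-≤1 : ∀ {Z} → All (_≤ 1) Z → ∀ t → sum (take t Z) ≤ t
sum-take-≤1 _           zero    = z≤n
sum-take-≤1 []          (suc t) = z≤n
sum-take-≤1 (z≤1 ∷ Z≤1) (suc t) = +-mono-≤ z≤1 (sum-take-≤1 Z≤1 t)

excessBound-≤1 : ∀ {s Z} Y → All (_≤ 1) Z → ExcessBound s Z Y
excessBound-≤1 Y Z≤1 zero    t _ = z≤n
excessBound-≤1 Y Z≤1 (suc i) t h = contradiction (≤-trans h (sum-take-≤1 Z≤1 (suc t))) (m+n≰n i t)
  where
  m+n≰n : ∀ i t → suc i + suc t ≰ suc t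
  m+n≰n i t le = n≮n (suc t) (≤-trans (s≤s (m≤n+m (suc t) i)) le)

excessBound-shift : ∀ {s Z Y} → ExcessBound (suc s) Z Y → ExcessBound s (1 ∷ Z) Y
excessBound-shift bound zero    t       _ = z≤n
excessBound-shift bound (suc i) zero    (s≤s h) with () ← m+n≤o⇒n≤o i h
excessBound-shift {s} bound i (suc t) h = begin
  sum (take i _)    ≤⟨ bound i t (≤-pred (≤-trans (≤-reflexive (sym (+-suc i (suc t)))) h)) ⟩
  i + t + suc s     ≡⟨ +-suc (i + t) s ⟩
  suc (i + t) + s   ≡⟨ cong (_+ s) (+-suc i t) ⟨
  i + suc t + s     ∎
  where open ≤-Reasoning

excessBound-cons : ∀ {s c Z Y} → ExcessBound s (c ∷ Z) Y →
                   ∀ x → ExcessBound (s + x) (suc c ∷ Z) (suc x ∷ Y)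
excessBound-cons         bound x zero    t _       = z≤n
excessBound-cons {s} {Y = Y} bound x (suc i) t (s≤s h) = begin
  suc x + sum (take i Y)  ≤⟨ +-monoʳ-≤ (suc x) (bound i t h) ⟩
  suc (x + (i + t + s))   ≡⟨ cong suc (+-comm x _) ⟩
  suc (i + t + s + x)     ≡⟨ cong suc (+-assoc (i + t) s x) ⟩
  suc i + t + (s + x)     ∎
  where open ≤-Reasoning

excessBound-ones : ∀ {s Z Y} → ExcessBound (suc s) Z Y →
                   ∀ m → ExcessBound s (suc m ∷ Z) (replicate m 1 ++ Y)
excessBound-ones         bound zero    = excessBound-shift bound
excessBound-ones {s} {Z} {Y} bound (suc m) =
  subst (λ s → ExcessBound s (suc (suc m) ∷ Z) (1 ∷ replicate m 1 ++ Y)) (+-identityʳ s)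
    (excessBound-cons (excessBound-ones bound m) 0)

block : ℕ → List ℕ
block c = 2 ∷ replicate (c ∸ 2) 1

excessBound-blocks : ∀ {Z Y} cs → All (2 ≤_) cs → ExcessBound 1 Z Y →
  ExcessBound 1 (cs ++ Z) (concatMap block cs ++ Y)
excessBound-blocks []                 []           bound = bound
excessBound-blocks                 (suc zero ∷ cs) (s≤s () ∷ _)
excessBound-blocks {Z} {Y} (suc (suc m) ∷ cs) (_ ∷ cs≥2) bound =
  subst (ExcessBound 1 (suc (suc m) ∷ cs ++ Z) ∘ (2 ∷_))
        (sym (++-assoc (replicate m 1) (concatMap block cs) Y))
    (excessBound-cons (excessBound-ones (excessBound-blocks cs cs≥2 bound) m) 1)

takeWhile-≥2 : ∀ xs → All (2 ≤_) (takeWhileᵇ (2 ≤ᵇ_) xs)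
takeWhile-≥2 xs = All.map (≤ᵇ⇒≤ 2 _) (All.all-takeWhile (T? ∘ (2 ≤ᵇ_)) xs)

dropWhile-≤1 : ∀ {xs} → Linked _≥_ xs → All (_≤ 1) (dropWhileᵇ (2 ≤ᵇ_) xs)
dropWhile-≤1 {[]}              _      = []
dropWhile-≤1 {zero ∷ xs}       linked = Linkedₚ.Linked⇒All (flip ≤-trans) z≤n linked
dropWhile-≤1 {suc zero ∷ xs}   linked = Linkedₚ.Linked⇒All (flip ≤-trans) ≤-refl linked
dropWhile-≤1 {suc (suc _) ∷ _} linked = dropWhile-≤1 (Linked.tail linked)

excessBound-lambdaBar : ∀ λ' → ExcessBound 0 (conjugate λ') (lambdaBar λ')
excessBound-lambdaBar λ'
  with takeWhileᵇ (2 ≤ᵇ_) (conjugate λ') | takeWhile-≥2 (conjugate λ')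
     | takeWhile++dropWhile (T? ∘ (2 ≤ᵇ_)) (conjugate λ')
... | []         | _        | split =
  subst (λ Z → ExcessBound 0 Z λ') split (excessBound-≤1 λ' rest≤1)
  where
  rest≤1 = dropWhile-≤1 (conjugate-linked λ')
... | zero ∷ _   | () ∷ _   | _
... | suc m ∷ cs | _ ∷ cs≥2 | split =
  subst (λ Z → ExcessBound 0 Z (replicate m 1 ++ concatMap block cs ++ [ X ])) split
    (excessBound-ones (excessBound-blocks cs cs≥2 (excessBound-≤1 [ X ] rest≤1)) m)
  where
  rest≤1 = dropWhile-≤1 (conjugate-linked λ')
  X : ℕ
  X = suc (length (conjugate λ') ∸ suc (length cs))

sum-replicate-1 : ∀ m → sum (replicate m 1) ≡ m
sum-replicate-1 zero    = refl
sum-replicate-1 (suc m) = cong suc (sum-replicate-1 m)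

sum-concatMap-block : ∀ {cs} → All (2 ≤_) cs → sum (concatMap block cs) ≡ sum cs
sum-concatMap-block []                       = refl
sum-concatMap-block {zero ∷ _}     (() ∷ _)
sum-concatMap-block {suc zero ∷ _} (s≤s () ∷ _)
sum-concatMap-block {suc (suc m) ∷ cs} (_ ∷ cs≥2) = begin
  sum (block (suc (suc m)) ++ concatMap block cs)
    ≡⟨ sum-++ (block (suc (suc m))) _ ⟩
  2 + sum (replicate m 1) + sum (concatMap block cs)
    ≡⟨ cong₂ (λ a b → 2 + a + b) (sum-replicate-1 m) (sum-concatMap-block cs≥2) ⟩
  sum (suc (suc m) ∷ cs) ∎
  where open ≡-Reasoning

length≤sum : ∀ {xs} → All (1 ≤_) xs → length xs ≤ sum xs
length≤sum []           = z≤n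
length≤sum (x≥1 ∷ xs≥1) = +-mono-≤ x≥1 (length≤sum xs≥1)

sum-lambdaBar : ∀ λ' → All (_≤ headOr0 λ') λ' → sum (lambdaBar λ') ≤ sum λ'
sum-lambdaBar λ' ≤head
  with takeWhileᵇ (2 ≤ᵇ_) (conjugate λ') | takeWhile-≥2 (conjugate λ')
     | takeWhile++dropWhile (T? ∘ (2 ≤ᵇ_)) (conjugate λ')
... | []         | _         | _     = ≤-refl
... | zero ∷ _   | () ∷ _    | _
... | suc m ∷ cs | _ ∷ cs≥2 | split = begin
  sum (replicate m 1 ++ concatMap block cs ++ [ suc L ])
    ≡⟨ sum-++ (replicate m 1) _ ⟩
  sum (replicate m 1) + sum (concatMap block cs ++ [ suc L ])
    ≡⟨ cong₂ _+_ (sum-replicate-1 m) (sum-++ (concatMap block cs) [ suc L ]) ⟩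
  m + (sum (concatMap block cs) + (suc L + 0))
    ≡⟨ cong (m +_) (cong₂ _+_ (sum-concatMap-block cs≥2)
                              (trans (+-identityʳ (suc L)) (cong suc L≡length-rest))) ⟩
  m + (sum cs + suc (length rest))
    ≤⟨ +-monoʳ-≤ m (+-monoʳ-≤ (sum cs) (s≤s (length≤sum rest≥1))) ⟩
  m + (sum cs + suc (sum rest))
    ≡⟨ cong (m +_) (+-suc (sum cs) (sum rest)) ⟩
  m + suc (sum cs + sum rest)
    ≡⟨ +-suc m _ ⟩
  suc m + (sum cs + sum rest)
    ≡⟨ cong (suc m +_) (sum-++ cs rest) ⟨
  sum (suc m ∷ cs ++ rest)
    ≡⟨ cong sum split ⟩
  sum (conjugate λ')
    ≡⟨ sum-conjugate λ' ≤head ⟩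
  sum λ' ∎
  where
  open ≤-Reasoning
  rest : List ℕ
  rest = dropWhileᵇ (2 ≤ᵇ_) (conjugate λ')
  rest≥1 : All (1 ≤_) rest
  rest≥1 = All.dropWhile⁺ (T? ∘ (2 ≤ᵇ_)) (conjugate-positive λ')
  L : ℕ
  L = length (conjugate λ') ∸ suc (length cs)
  L≡length-rest : L ≡ length rest
  L≡length-rest = begin-equality
    length (conjugate λ') ∸ suc (length cs) ≡⟨ cong (λ l → length l ∸ suc (length cs)) split ⟨
    length (cs ++ rest) ∸ length cs         ≡⟨ cong (_∸ length cs) (length-++ cs) ⟩
    length cs + length rest ∸ length cs     ≡⟨ m+n∸m≡n (length cs) (length rest) ⟩
    length rest                             ∎

isDescent : List (List ℕ) → ℕ → Bool
isDescent T j = rowOf T j <ᵇ rowOf T (suc j)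

lambdaBar-descents : ∀ n λ' T → All (_≤ headOr0 λ') λ' → map length T ≡ λ' →
  concat T ↭ applyUpTo suc n → ∀ m → m < n → sum (take (count (isDescent T) m) (lambdaBar λ')) ≤ m
lambdaBar-descents n λ' T ≤head shape entries m m<n =
  subst (sum (take d (lambdaBar λ')) ≤_) (trans (+-identityʳ (d + t)) (count-not (isDescent T) m))
    (excessBound-lambdaBar λ' d t (begin
      d + suc t                                  ≡⟨ +-suc d t ⟩
      suc (d + t)                                ≡⟨ cong suc (count-not (isDescent T) m) ⟩
      suc m                                      ≤⟨ prefix≤rowCapacity n T entries m m<n ⟩
      sum (map (_⊓ suc t) (map length T))        ≡⟨ cong (sum ∘ map (_⊓ suc t)) shape ⟩
      sum (map (_⊓ suc t) λ')                    ≡⟨ sum-take-conjugate λ' ≤head (suc t) ⟨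
      sum (take (suc t) (conjugate λ'))          ∎))
  where
  open ≤-Reasoning
  d t : ℕ
  d = count (isDescent T) m
  t = nonAscents (rowOf T) m

Majorises : (ℕ → ℕ) → ℕ → List ℕ → Set
Majorises Q c []       = ⊤
Majorises Q c (x ∷ xs) = Q (suc c) ≤ x × Majorises Q (suc c) xs

module _ {Q : ℕ → ℕ} where

  majorises-++ : ∀ {c} xs {ys} → Majorises Q c xs → Majorises Q (c + length xs) ys →
                 Majorises Q c (xs ++ ys)
  majorises-++ {c} []       _          rest rewrite +-identityʳ c = rest
  majorises-++ {c} (x ∷ xs) {ys} (qx , qxs) rest =
    qx , majorises-++ xs qxs (subst (λ c′ → Majorises Q c′ ys) (+-suc c (length xs)) rest)

  length-filterᵇ-upTo : ∀ (p : ℕ → Bool) k → length (filterᵇ p (applyUpTo suc k)) ≡ count p k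
  length-filterᵇ-upTo p zero    = refl
  length-filterᵇ-upTo p (suc k) = begin
    length (filterᵇ p (applyUpTo suc (suc k)))
      ≡⟨ cong (length ∘ filterᵇ p) (applyUpTo-∷ʳ suc k) ⟨
    length (filterᵇ p (applyUpTo suc k ++ [ suc k ]))
      ≡⟨ cong length (filter-++ (T? ∘ p) (applyUpTo suc k) [ suc k ]) ⟩
    length (filterᵇ p (applyUpTo suc k) ++ filterᵇ p [ suc k ])
      ≡⟨ length-++ (filterᵇ p (applyUpTo suc k)) ⟩
    length (filterᵇ p (applyUpTo suc k)) + length (filterᵇ p [ suc k ])
      ≡⟨ cong₂ _+_ (length-filterᵇ-upTo p k) (length-filterᵇ-∷ p (suc k) []) ⟩
    count p k + (indicator (p (suc k)) + 0)
      ≡⟨ cong (count p k +_) (+-identityʳ _) ⟩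
    count p (suc k) ∎
    where open ≡-Reasoning

  -- The j-th element x of the filtered list satisfies j = count p x.
  majorises-filterᵇ : ∀ (p : ℕ → Bool) k → (∀ x → 1 ≤ x → x ≤ k → T (p x) → Q (count p x) ≤ x) →
                      Majorises Q 0 (filterᵇ p (applyUpTo suc k))
  majorises-filterᵇ p zero    _     = tt
  majorises-filterᵇ p (suc k) bound =
    subst (Majorises Q 0 ∘ filterᵇ p) (applyUpTo-∷ʳ suc k)
      (subst (Majorises Q 0) (sym (filter-++ (T? ∘ p) (applyUpTo suc k) [ suc k ]))
        (majorises-++ (filterᵇ p (applyUpTo suc k))
          (majorises-filterᵇ p k (λ x 1≤x x≤k → bound x 1≤x (m≤n⇒m≤1+n x≤k)))
          (subst (λ c → Majorises Q c (filterᵇ p [ suc k ])) (sym (length-filterᵇ-upTo p k)) last)))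
    where
    last : Majorises Q (count p k) (filterᵇ p [ suc k ])
    last with p (suc k) | bound (suc k) (s≤s z≤n) ≤-refl
    ... | false | _  = tt
    ... | true  | Qx≤x = subst (λ c → Q c ≤ suc k) (+-comm (count p k) 1) (Qx≤x tt) , tt

  -- As prev + (a ∸ prev) ≥ a, D need not be increasing.
  majorises-diffs : ∀ {n} → (∀ j → Q j ≤ n) → ∀ D prev c → Q c ≤ prev → Majorises Q c D →
                    ∀ i → Q (c + i) ≤ prev + sum (take i (diffs n prev D))
  majorises-diffs         _   D        prev c Qc≤prev _          zero
    rewrite +-identityʳ c | +-identityʳ prev = Qc≤prev
  majorises-diffs {n} Q≤n []       prev c _       _          (suc i) = begin
    Q (c + suc i)                     ≤⟨ Q≤n _ ⟩
    n                                 ≤⟨ m≤n+m∸n n prev ⟩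
    prev + (n ∸ prev)                 ≤⟨ +-monoʳ-≤ prev (m≤m+n _ _) ⟩
    prev + (n ∸ prev + sum (take i [])) ∎
    where open ≤-Reasoning
  majorises-diffs {n} Q≤n (a ∷ D)  prev c _ (Qc+1≤a , QD) (suc i) = begin
    Q (c + suc i)                                  ≡⟨ cong Q (+-suc c i) ⟩
    Q (suc c + i)                                  ≤⟨ majorises-diffs Q≤n D a (suc c) Qc+1≤a QD i ⟩
    a + sum (take i (diffs n a D))                 ≤⟨ +-monoˡ-≤ _ (m≤n+m∸n a prev) ⟩
    prev + (a ∸ prev) + sum (take i (diffs n a D)) ≡⟨ +-assoc prev (a ∸ prev) _ ⟩
    prev + (a ∸ prev + sum (take i (diffs n a D))) ∎
    where open ≤-Reasoning

≤headOr0 : ∀ {xs} → Linked _≥_ xs → All (_≤ headOr0 xs) xs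
≤headOr0 {[]}    _      = []
≤headOr0 {_ ∷ _} linked = Linkedₚ.Linked⇒All (flip ≤-trans) ≤-refl linked

sum-take≤sum : ∀ j (xs : List ℕ) → sum (take j xs) ≤ sum xs
sum-take≤sum zero    xs       = z≤n
sum-take≤sum (suc j) []       = z≤n
sum-take≤sum (suc j) (x ∷ xs) = +-monoʳ-≤ x (sum-take≤sum j xs)

≤∸1⇒< : ∀ {m n} → 1 ≤ m → m ≤ n ∸ 1 → m < n
≤∸1⇒< {n = zero}  (s≤s z≤n) ()
≤∸1⇒< {n = suc n} _         m≤n = s≤s m≤n

mainTheorem20 : (n : ℕ) (λ' α : List ℕ) → IsPartition n λ' → IsComposition n α →
    (T : List (List ℕ)) → IsSYT n λ' T → des n T ≡ α → Dominates α (lambdaBar λ')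
mainTheorem20 n λ' α (_ , decreasing , sum≡n) _ T (shape , entries , _ , _) refl =
  majorises-diffs Q≤n (Des n T) 0 0 z≤n
    (majorises-filterᵇ (isDescent T) (n ∸ 1) (λ m 1≤m m≤n-1 _ →
      lambdaBar-descents n λ' T ≤head shape entries m (≤∸1⇒< 1≤m m≤n-1)))
  where
  ≤head : All (_≤ headOr0 λ') λ'
  ≤head = ≤headOr0 decreasing
  Q≤n : ∀ j → sum (take j (lambdaBar λ')) ≤ n
  Q≤n j = ≤-trans (sum-take≤sum j (lambdaBar λ'))
                  (≤-trans (sum-lambdaBar λ' ≤head) (≤-reflexive sum≡n))
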